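{- Let $U$ be an infinite set, $(\mathscr{S},\sqsubseteq)$ a partially ordered set, $(\mathfrak{R},\subseteq)$ a linearly ordered set, $\sigma$ a map from $\mathscr{S}$ to the set of infinite subsets of $U$ and $\rho:\mathscr{S}\to\mathfrak{R}$ a map such that for all $\underline X,\underline Y\in\mathscr S$: (i) $\underline X\sqsubseteq\underline Y$ implies $\sigma(\underline X)\subseteq\sigma(\underline Y)$; (ii) $\underline X\sqsubseteq\underline Y$ implies $\rho(\underline X)\subseteq\rho(\underline Y)$; (iii) for every $\mathfrak r\in\mathfrak R$ with $\mathfrak r\subseteq\rho(\underline X)$ there is $\underline R\in\mathscr S$ with $\underline R\sqsubseteq\underline X$ and $\rho(\underline R)=\mathfrak r$; (iv) $\mathscr S$ has a maximum $\underline U$ with $\sigma(\underline U)=U$. Let $(S,P)$ be a partition of $U$. Then there is $Q\in\{S,P\}$ such that $Q$ is large, and there exist a refinement $\underline V$ of $\underline U$ and a set $\mathscr V\subseteq\mathscr S$ with $\underline V\in\mathscr V$ such that for every $\underline X\in\mathscr V$: (1) $Q\cap\sigma(\underline X)$ is infinite; (2) every refinement of $\underline X$ belongs to $\mathscr V$; (3) $\gamma_{\mathscr V}(\underline X)$ holds.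
   Context: A refinement of $\underline Y$ is any $\underline X\sqsubseteq\underline Y$ with $\rho(\underline X)=\rho(\underline Y)$; an $\mathfrak r$-restriction of $\underline Y$ is any $\underline X\sqsubseteq\underline Y$ with $\rho(\underline X)=\mathfrak r$. For $\mathscr W\subseteq\mathscr S$ and $\underline X\in\mathscr S$, $\phi_{\mathscr W}(\underline X)$ is the statement: for every $\mathfrak r\in\mathfrak R$ with $\mathfrak r\subseteq\rho(\underline X)$ there is a refinement $\underline Y$ of $\underline X$ such that for every refinement $\underline Z$ of $\underline Y$ there is an $\mathfrak r$-restriction $\underline R$ of $\underline Z$ with $\underline R\in\mathscr W$. A set $Q\subseteq U$ is large if there is $\mathscr W\subseteq\mathscr S$ with $\underline U\in\mathscr W$ such that for every $\underline X\in\mathscr W$ the set $Q\cap\sigma(\underline X)$ is infinite and $\phi_{\mathscr W}(\underline X)$ holds. For $\mathscr Z\subseteq\mathscr S$, $\gamma_{\mathscr Z}(\underline X)$ is the statement: for every refinement $\underline Y$ of $\underline X$ and every $\mathfrak r\in\mathfrak R$ with $\mathfrak r\subseteq\rho(\underline X)$ there is an $\mathfrak r$-restriction $\underline R$ of $\underline Y$ with $\underline R\in\mathscr Z$. -}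

module Defs where

open import Level using (0ℓ)
open import Data.Nat using (ℕ)
open import Data.Fin using (Fin)
open import Data.Product using (Σ; Σ-syntax; ∃; _×_)
open import Relation.Nullary using (¬_)
open import Relation.Unary using (Pred; _∩_)
open import Relation.Binary using (Rel)
open import Relation.Binary.PropositionalEquality using (_≡_)

Finite : {U : Set} → Pred U 0ℓ → Set
Finite {U} A = Σ[ n ∈ ℕ ] Σ[ f ∈ (Fin n → U) ] (∀ x → A x → ∃ λ i → f i ≡ x)

Infinite : {U : Set} → Pred U 0ℓ → Set
Infinite A = ¬ Finite A

module Frame {U 𝒮 ℜ : Set}
             (_⊑_ : Rel 𝒮 0ℓ) (_⊆ᵣ_ : Rel ℜ 0ℓ)
             (σ : 𝒮 → Pred U 0ℓ) (ρ : 𝒮 → ℜ) where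

  IsRefinement : 𝒮 → 𝒮 → Set
  IsRefinement X Y = (X ⊑ Y) × (ρ X ≡ ρ Y)

  IsRestriction : ℜ → 𝒮 → 𝒮 → Set
  IsRestriction r X Y = (X ⊑ Y) × (ρ X ≡ r)

  φ : Pred 𝒮 0ℓ → 𝒮 → Set
  φ 𝒲 X = ∀ r → r ⊆ᵣ ρ X →
            Σ[ Y ∈ 𝒮 ] (IsRefinement Y X ×
              (∀ Z → IsRefinement Z Y →
                 Σ[ R ∈ 𝒮 ] (IsRestriction r R Z × 𝒲 R)))

  Large : 𝒮 → Pred U 0ℓ → Set₁
  Large 𝑈 Q = Σ[ 𝒲 ∈ Pred 𝒮 0ℓ ] (𝒲 𝑈 ×
                (∀ X → 𝒲 X → Infinite (Q ∩ σ X) × φ 𝒲 X))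

  γ : Pred 𝒮 0ℓ → 𝒮 → Set
  γ 𝒵 X = ∀ Y → IsRefinement Y X → ∀ r → r ⊆ᵣ ρ X →
            Σ[ R ∈ 𝒮 ] (IsRestriction r R Y × 𝒵 R)

  Conclusion : 𝒮 → Pred U 0ℓ → Set₁
  Conclusion 𝑈 Q =
    Large 𝑈 Q ×
    Σ[ V ∈ 𝒮 ] Σ[ 𝒱 ∈ Pred 𝒮 0ℓ ]
      (IsRefinement V 𝑈 × 𝒱 V ×
       (∀ X → 𝒱 X →
          Infinite (Q ∩ σ X) ×
          (∀ Y → IsRefinement Y X → 𝒱 Y) ×
          γ 𝒱 X))

-- Call a family 𝒱 ⊆ 𝒮 Q-good when every member X satisfies properties (1)-(3)
-- of the theorem: Q ∩ σ X is infinite, refinements of X stay in 𝒱, and γ_𝒱(X).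
-- A Q-good family containing a refinement of 𝑈 already witnesses that Q is
-- large, so the theorem reduces to: S or P admits such a family.
--
-- Classically, the union 𝒞 Q of all Q-good families is the greatest Q-good
-- family.  If some refinement of 𝑈 lies in 𝒞 S we are done with Q = S.
-- Otherwise 𝑈 belongs to the family of sets X that "avoid 𝒞 S" (no refinement
-- of X lies in 𝒞 S), and we show that this family is P-good:
--   * if P ∩ σ X were finite, the down-set of X would be S-good;
--   * if some refinement Y of X had no r-restriction avoiding 𝒞 S, then Y would
--     "approach 𝒞 S at level r", and the approaching sets together with 𝒞 S
--     form an S-good family, so Y ∈ 𝒞 S, contradicting that X avoids 𝒞 S.
module Submission where

open import Defs
open import Level using (0ℓ; suc; lift; lower)
open import Axiom.ExcludedMiddle using (ExcludedMiddle)
open import Data.Unit using (⊤)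
open import Data.Empty using (⊥-elim)
open import Data.Fin using (Fin; splitAt; _↑ˡ_; _↑ʳ_)
open import Data.Fin.Properties using (splitAt-↑ˡ; splitAt-↑ʳ)
open import Data.Nat using (_+_)
open import Data.Product using (Σ; Σ-syntax; _×_; _,_; proj₁; proj₂)
open import Data.Sum using (_⊎_; inj₁; inj₂; [_,_]′)
open import Function using (_∘_)
open import Relation.Nullary using (¬_; Dec; yes; no)
open import Relation.Nullary.Decidable
  using (True; toWitness; fromWitness; map′; decidable-stable)
open import Relation.Unary using (Pred; _⊆_; _∩_; _∪_)
open import Relation.Binary
  using (Rel; Total; IsPreorder; IsPartialOrder; IsTotalOrder)
open import Relation.Binary.PropositionalEquality
  using (_≡_; refl; sym; trans; subst; cong)

module _ {U : Set} where

  finite-⊆ : {A B : Pred U 0ℓ} → A ⊆ B → Finite B → Finite A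
  finite-⊆ A⊆B (n , f , covers) = n , f , λ x x∈A → covers x (A⊆B x∈A)

  finite-∪ : {A B : Pred U 0ℓ} → Finite A → Finite B → Finite (A ∪ B)
  finite-∪ {A} {B} (n , f , coversA) (m , g , coversB) = n + m , h , covers
    where
    h : Fin (n + m) → U
    h = [ f , g ]′ ∘ splitAt n

    covers : ∀ x → (A ∪ B) x → Σ[ i ∈ Fin (n + m) ] h i ≡ x
    covers x (inj₁ x∈A) =
      let (i , fi≡x) = coversA x x∈A
      in i ↑ˡ m , trans (cong [ f , g ]′ (splitAt-↑ˡ n i m)) fi≡x
    covers x (inj₂ x∈B) =
      let (i , gi≡x) = coversB x x∈B
      in n ↑ʳ i , trans (cong [ f , g ]′ (splitAt-↑ʳ n m i)) gi≡x

  infinite-⊆ : {A B : Pred U 0ℓ} → A ⊆ B → Infinite A → Infinite B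
  infinite-⊆ A⊆B infA = infA ∘ finite-⊆ A⊆B

  infinite-remainder : {A B C : Pred U 0ℓ} →
    Infinite C → C ⊆ A ∪ B → Finite B → Infinite A
  infinite-remainder infC C⊆A∪B finB finA =
    infC (finite-⊆ C⊆A∪B (finite-∪ finA finB))

module Families {U 𝒮 ℜ : Set}
  (_⊑_ : Rel 𝒮 0ℓ) (⊑-isPreorder : IsPreorder _≡_ _⊑_)
  (_⊆ᵣ_ : Rel ℜ 0ℓ)
  (σ : 𝒮 → Pred U 0ℓ) (ρ : 𝒮 → ℜ)
  (σ-mono : ∀ X Y → X ⊑ Y → σ X ⊆ σ Y)
  where

  open Frame _⊑_ _⊆ᵣ_ σ ρ
  open IsPreorder ⊑-isPreorder using () renaming (refl to ⊑-refl; trans to ⊑-trans)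

  Good : Pred U 0ℓ → Pred 𝒮 0ℓ → Set
  Good Q 𝒱 = ∀ X → 𝒱 X →
    Infinite (Q ∩ σ X) × (∀ Y → IsRefinement Y X → 𝒱 Y) × γ 𝒱 X

  module _ {Q : Pred U 0ℓ} {𝒱 : Pred 𝒮 0ℓ} (good : Good Q 𝒱) {X : 𝒮} (X∈𝒱 : 𝒱 X) where
    good-infinite : Infinite (Q ∩ σ X)
    good-infinite = proj₁ (good X X∈𝒱)

    good-closed : ∀ Y → IsRefinement Y X → 𝒱 Y
    good-closed = proj₁ (proj₂ (good X X∈𝒱))

    good-γ : γ 𝒱 X
    good-γ = proj₂ (proj₂ (good X X∈𝒱))

  refinement-refl : ∀ X → IsRefinement X X
  refinement-refl X = ⊑-refl , refl

  refinement-trans : ∀ {X Y Z} → IsRefinement X Y → IsRefinement Y Z → IsRefinement X Z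
  refinement-trans (X⊑Y , ρX≡ρY) (Y⊑Z , ρY≡ρZ) = ⊑-trans X⊑Y Y⊑Z , trans ρX≡ρY ρY≡ρZ

  restriction-⊑ : ∀ {r R X Y} → IsRestriction r R Y → Y ⊑ X → IsRestriction r R X
  restriction-⊑ (R⊑Y , ρR≡r) Y⊑X = ⊑-trans R⊑Y Y⊑X , ρR≡r

  -- If V refines X and satisfies γ_𝒱, then X satisfies φ_𝒲 for any 𝒲 ⊇ 𝒱:
  -- V itself is the refinement required by φ.
  γ⇒φ : ∀ {𝒱 𝒲 : Pred 𝒮 0ℓ} {V X} →
    IsRefinement V X → γ 𝒱 V → (∀ {Y} → 𝒱 Y → 𝒲 Y) → φ 𝒲 X
  γ⇒φ {V = V} (V⊑X , ρV≡ρX) γV 𝒱⊆𝒲 r r⊆ρX =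
    V , (V⊑X , ρV≡ρX) , λ Z Z-ref →
      let (R , R-res , R∈𝒱) = γV Z Z-ref r (subst (r ⊆ᵣ_) (sym ρV≡ρX) r⊆ρX)
      in R , R-res , 𝒱⊆𝒲 R∈𝒱

  -- A Q-good family containing a refinement of 𝑈 shows that Q is large:
  -- add 𝑈 to the family and witness φ by γ.
  good⇒large : ∀ {Q 𝒱 V} 𝑈 → IsRefinement V 𝑈 → Good Q 𝒱 → 𝒱 V → Large 𝑈 Q
  good⇒large {Q} {𝒱} {V} 𝑈 V-ref good V∈𝒱 = 𝒲 , inj₂ refl , large
    where
    𝒲 : Pred 𝒮 0ℓ
    𝒲 X = 𝒱 X ⊎ X ≡ 𝑈

    large : ∀ X → 𝒲 X → Infinite (Q ∩ σ X) × φ 𝒲 X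
    large X (inj₁ X∈𝒱) =
      good-infinite good X∈𝒱 , γ⇒φ (refinement-refl X) (good-γ good X∈𝒱) inj₁
    large X (inj₂ refl) =
      infinite-⊆ (λ (q , v) → q , σ-mono V 𝑈 (proj₁ V-ref) v) (good-infinite good V∈𝒱) ,
      γ⇒φ V-ref (good-γ good V∈𝒱) inj₁

  module Restrictions
    (restrict : ∀ X r → r ⊆ᵣ ρ X → Σ[ R ∈ 𝒮 ] ((R ⊑ X) × (ρ R ≡ r)))
    where

    restrict-refinement : ∀ {X Y r} → IsRefinement Y X → r ⊆ᵣ ρ X →
      Σ[ R ∈ 𝒮 ] IsRestriction r R Y
    restrict-refinement {Y = Y} {r} (_ , ρY≡ρX) r⊆ρX =
      let (R , R⊑Y , ρR≡r) = restrict Y r (subst (r ⊆ᵣ_) (sym ρY≡ρX) r⊆ρX)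
      in R , (R⊑Y , ρR≡r)

    down-set-good : ∀ {Q X} → (∀ Y → Y ⊑ X → Infinite (Q ∩ σ Y)) → Good Q (_⊑ X)
    down-set-good inf Y Y⊑X =
      inf Y Y⊑X ,
      (λ Z (Z⊑Y , _) → ⊑-trans Z⊑Y Y⊑X) ,
      λ Z Z-ref r r⊆ρY →
        let (R , R⊑Z , ρR≡r) = restrict-refinement Z-ref r⊆ρY
        in R , (R⊑Z , ρR≡r) , ⊑-trans R⊑Z (⊑-trans (proj₁ Z-ref) Y⊑X)

    module Classical
      (⊆ᵣ-total : Total _⊆ᵣ_)
      (em : ExcludedMiddle (suc 0ℓ))
      where

      em₀ : {A : Set} → Dec A
      em₀ = map′ lower lift em

      -- The union of all Q-good families; it is the greatest Q-good family.
      𝒞 : Pred U 0ℓ → Pred 𝒮 0ℓ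
      𝒞 Q X = True (em {Σ[ 𝒱 ∈ Pred 𝒮 0ℓ ] (Good Q 𝒱 × 𝒱 X)})

      good⊆𝒞 : ∀ {Q 𝒱 X} → Good Q 𝒱 → 𝒱 X → 𝒞 Q X
      good⊆𝒞 {𝒱 = 𝒱} good X∈𝒱 = fromWitness (𝒱 , good , X∈𝒱)

      𝒞-good : ∀ Q → Good Q (𝒞 Q)
      𝒞-good Q X X∈𝒞 =
        let (𝒱 , good , X∈𝒱) = toWitness X∈𝒞
        in good-infinite good X∈𝒱 ,
           (λ Y Y-ref → good⊆𝒞 good (good-closed good X∈𝒱 Y Y-ref)) ,
           λ Y Y-ref r r⊆ρX →
             let (R , R-res , R∈𝒱) = good-γ good X∈𝒱 Y Y-ref r r⊆ρX
             in R , R-res , good⊆𝒞 good R∈𝒱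

      Approaches : Pred U 0ℓ → ℜ → Pred 𝒮 0ℓ
      Approaches Q r X = r ⊆ᵣ ρ X ×
        (∀ R → IsRestriction r R X → Σ[ R′ ∈ 𝒮 ] (IsRefinement R′ R × 𝒞 Q R′))

      module _ {Q : Pred U 0ℓ} {r : ℜ} where

        -- σ X contains σ of a member of 𝒞 Q, hence meets Q infinitely.
        approaches-infinite : ∀ {X} → Approaches Q r X → Infinite (Q ∩ σ X)
        approaches-infinite {X} (r⊆ρX , refine) =
          let (R , R⊑X , ρR≡r) = restrict X r r⊆ρX
              (R′ , (R′⊑R , _) , R′∈𝒞) = refine R (R⊑X , ρR≡r)
          in infinite-⊆ (λ (q , s) → q , σ-mono R X R⊑X (σ-mono R′ R R′⊑R s))
                        (good-infinite (𝒞-good Q) R′∈𝒞)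

        -- Refinements keep ρ and have fewer restrictions.
        approaches-closed : ∀ {X} → Approaches Q r X →
          ∀ Y → IsRefinement Y X → Approaches Q r Y
        approaches-closed (r⊆ρX , refine) Y (Y⊑X , ρY≡ρX) =
          subst (r ⊆ᵣ_) (sym ρY≡ρX) r⊆ρX ,
          λ R R-res → refine R (restriction-⊑ R-res Y⊑X)

        -- γ for the family 𝒞 Q ∪ Approaches Q r, split on the order of r and
        -- the requested level r′: above r the r′-restriction still approaches
        -- 𝒞 Q, below r we pass through a member of 𝒞 Q and use its γ.
        approaches-γ : ∀ {X} → Approaches Q r X → γ (𝒞 Q ∪ Approaches Q r) X
        approaches-γ (r⊆ρX , refine) Y Y-ref@(Y⊑X , ρY≡ρX) r′ r′⊆ρX
          with ⊆ᵣ-total r r′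
        ... | inj₁ r⊆r′ =
          let (R′ , R′⊑Y , ρR′≡r′) = restrict-refinement Y-ref r′⊆ρX
          in R′ , (R′⊑Y , ρR′≡r′) ,
             inj₂ (subst (r ⊆ᵣ_) (sym ρR′≡r′) r⊆r′ ,
                   λ R R-res → refine R (restriction-⊑ R-res (⊑-trans R′⊑Y Y⊑X)))
        ... | inj₂ r′⊆r =
          let (R , R-res) = restrict-refinement Y-ref r⊆ρX
              (R′ , (R′⊑R , ρR′≡ρR) , R′∈𝒞) = refine R (restriction-⊑ R-res Y⊑X)
              r′⊆ρR′ = subst (r′ ⊆ᵣ_) (sym (trans ρR′≡ρR (proj₂ R-res))) r′⊆r
              (R″ , (R″⊑R′ , ρR″≡r′) , R″∈𝒞) =
                good-γ (𝒞-good Q) R′∈𝒞 R′ (refinement-refl R′) r′ r′⊆ρR′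
          in R″ , (⊑-trans R″⊑R′ (⊑-trans R′⊑R (proj₁ R-res)) , ρR″≡r′) , inj₁ R″∈𝒞

        extension-good : Good Q (𝒞 Q ∪ Approaches Q r)
        extension-good X (inj₁ X∈𝒞) =
          let (inf , closed , γX) = 𝒞-good Q X X∈𝒞
          in inf , (λ Y Y-ref → inj₁ (closed Y Y-ref)) ,
             λ Y Y-ref r′ r′⊆ρX →
               let (R , R-res , R∈𝒞) = γX Y Y-ref r′ r′⊆ρX in R , R-res , inj₁ R∈𝒞
        extension-good X (inj₂ X-app) =
          approaches-infinite X-app ,
          (λ Y Y-ref → inj₂ (approaches-closed X-app Y Y-ref)) ,
          approaches-γ X-app

        approaches⊆𝒞 : ∀ {X} → Approaches Q r X → 𝒞 Q X
        approaches⊆𝒞 X-app = good⊆𝒞 extension-good (inj₂ X-app)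

      Avoids : Pred U 0ℓ → Pred 𝒮 0ℓ
      Avoids Q X = ¬ (Σ[ V ∈ 𝒮 ] (IsRefinement V X × 𝒞 Q V))

      avoids-good : ∀ {Q P} → (∀ X → Infinite (σ X)) → (∀ x → Q x ⊎ P x) →
        Good P (Avoids Q)
      avoids-good {Q} {P} σ-infinite cover X X-avoids =
        infinite , closed , γ-avoids
        where
        -- If P ∩ σ X were finite, Q would meet σ Y infinitely for all Y ⊑ X,
        -- so the down-set of X would be Q-good and X would lie in 𝒞 Q.
        infinite : Infinite (P ∩ σ X)
        infinite P∩σX-finite =
          X-avoids (X , refinement-refl X , good⊆𝒞 (down-set-good Q-inf) ⊑-refl)
          where
          Q-inf : ∀ Y → Y ⊑ X → Infinite (Q ∩ σ Y)
          Q-inf Y Y⊑X =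
            infinite-remainder (σ-infinite Y)
              (λ {x} s → [ (λ q → inj₁ (q , s)) , (λ p → inj₂ (p , σ-mono Y X Y⊑X s)) ]′ (cover x))
              P∩σX-finite

        closed : ∀ Y → IsRefinement Y X → Avoids Q Y
        closed Y Y-ref (V , V-ref , V∈𝒞) = X-avoids (V , refinement-trans V-ref Y-ref , V∈𝒞)

        -- If no r-restriction of Y avoided 𝒞 Q, Y would approach 𝒞 Q at r.
        γ-avoids : γ (Avoids Q) X
        γ-avoids Y Y-ref r r⊆ρX
          with em₀ {Σ[ R ∈ 𝒮 ] (IsRestriction r R Y × Avoids Q R)}
        ... | yes witness = witness
        ... | no none = ⊥-elim (X-avoids (Y , Y-ref , approaches⊆𝒞 Y-app))
          where
          Y-app : Approaches Q r Y
          Y-app = subst (r ⊆ᵣ_) (sym (proj₂ Y-ref)) r⊆ρX ,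
                  λ R R-res → decidable-stable em₀ (λ R-avoids → none (R , R-res , R-avoids))

      dichotomy : ∀ {Q P} 𝑈 → (∀ X → Infinite (σ X)) → (∀ x → Q x ⊎ P x) →
        Conclusion 𝑈 Q ⊎ Conclusion 𝑈 P
      dichotomy {Q} {P} 𝑈 σ-infinite cover
        with em₀ {Σ[ V ∈ 𝒮 ] (IsRefinement V 𝑈 × 𝒞 Q V)}
      ... | yes (V , V-ref , V∈𝒞) =
        inj₁ (good⇒large 𝑈 V-ref (𝒞-good Q) V∈𝒞 , V , 𝒞 Q , V-ref , V∈𝒞 , 𝒞-good Q)
      ... | no 𝑈-avoids =
        inj₂ (good⇒large 𝑈 (refinement-refl 𝑈) avoiding 𝑈-avoids ,
              𝑈 , Avoids Q , refinement-refl 𝑈 , 𝑈-avoids , avoiding)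
        where
        avoiding : Good P (Avoids Q)
        avoiding = avoids-good σ-infinite cover

theorem7p2 : ExcludedMiddle (suc 0ℓ) →
    (U 𝒮 ℜ : Set) →
    Infinite {U} (λ _ → ⊤) →
    (_⊑_ : Rel 𝒮 0ℓ) → IsPartialOrder _≡_ _⊑_ →
    (_⊆ᵣ_ : Rel ℜ 0ℓ) → IsTotalOrder _≡_ _⊆ᵣ_ →
    (σ : 𝒮 → Pred U 0ℓ) → (∀ X → Infinite (σ X)) →
    (ρ : 𝒮 → ℜ) →
    (∀ X Y → X ⊑ Y → σ X ⊆ σ Y) →
    (∀ X Y → X ⊑ Y → ρ X ⊆ᵣ ρ Y) →
    (∀ X r → r ⊆ᵣ ρ X → Σ[ R ∈ 𝒮 ] ((R ⊑ X) × (ρ R ≡ r))) →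
    (𝑈 : 𝒮) → (∀ X → X ⊑ 𝑈) → (∀ x → σ 𝑈 x) →
    (S P : Pred U 0ℓ) → (∀ x → S x ⊎ P x) → (∀ x → ¬ (S x × P x)) →
    Frame.Conclusion _⊑_ _⊆ᵣ_ σ ρ 𝑈 S ⊎ Frame.Conclusion _⊑_ _⊆ᵣ_ σ ρ 𝑈 P
theorem7p2 em U 𝒮 ℜ _ _⊑_ ⊑-isPartialOrder _⊆ᵣ_ ⊆ᵣ-isTotalOrder σ σ-infinite ρ
           σ-mono _ restrict 𝑈 _ _ S P cover _ =
  dichotomy 𝑈 σ-infinite cover
  where
  open Families _⊑_ (IsPartialOrder.isPreorder ⊑-isPartialOrder) _⊆ᵣ_ σ ρ σ-mono
  open Restrictions restrict
  open Classical (IsTotalOrder.total ⊆ᵣ-isTotalOrder) em
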